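{- Let $m\ge 3$. For the problem of minimizing makespan for online job scheduling on $m$ identical machines, every deterministic online algorithm $A$ has online bounded ratio at least $\frac{4}{3}$.
   Context: Jobs with positive sizes arrive online and each must be assigned irrevocably (without preemption) to one of $m$ identical machines; the load of a machine is the total size of its jobs, and the makespan is the maximum load; the goal is to minimize the makespan. For a deterministic online algorithm $A$ of a minimization problem, $\textsc{Opt}_A$ denotes an offline algorithm that is optimal among offline algorithms whose solution on any input $I$ satisfies, for every prefix $I'$ of $I$, that the cost of the solution restricted to $I'$ is at most $A(I')$. The online bounded ratio of $A$ is the infimum of all constants $c$ such that $A(I) \le c\,\textsc{Opt}_A(I)$ for all inputs $I$.
   Formalization: Job sizes are positive rationals, and the constants c in the definition of the online bounded ratio range over ℚ. -}

module Defs where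

open import Data.Nat using (ℕ)
open import Data.Fin using (Fin; _≟_)
open import Data.List using (List; []; _∷_; _++_; [_]; map; take; foldr)
open import Data.List.Relation.Unary.All using (All)
open import Data.Product using (Σ; _×_; _,_; proj₁; proj₂)
open import Data.Rational using (ℚ; 0ℚ; _+_; _*_; _⊔_; _≤_; Positive)
open import Relation.Binary.PropositionalEquality using (_≡_)
open import Relation.Nullary using (yes; no)

-- A deterministic online algorithm for m machines: given the sizes of the
-- previously arrived jobs (in arrival order) and the size of the new job,
-- it irrevocably chooses a machine for the new job.
OnlineAlg : ℕ → Set
OnlineAlg m = List ℚ → ℚ → Fin m

-- A schedule: the jobs in arrival order, each paired with its machine.
Schedule : ℕ → Set
Schedule m = List (ℚ × Fin m)

load : {m : ℕ} → Schedule m → Fin m → ℚ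
load [] i = 0ℚ
load ((x , j) ∷ s) i with j ≟ i
... | yes _ = x + load s i
... | no  _ = load s i

-- makespan = maximum load over all machines (loads are ≥ 0 for positive jobs)
makespan : {m : ℕ} → Schedule m → ℚ
makespan {m} s = foldr (λ i r → load s i ⊔ r) 0ℚ (Data.List.allFin m)

runFrom : {m : ℕ} → OnlineAlg m → List ℚ → List ℚ → Schedule m
runFrom A seen []       = []
runFrom A seen (x ∷ xs) = (x , A seen x) ∷ runFrom A (seen ++ [ x ]) xs

run : {m : ℕ} → OnlineAlg m → List ℚ → Schedule m
run A I = runFrom A [] I

cost : {m : ℕ} → OnlineAlg m → List ℚ → ℚ
cost A I = makespan (run A I)

Feasible : {m : ℕ} → OnlineAlg m → List ℚ → Schedule m → Set
Feasible A I σ =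
  (map proj₁ σ ≡ I) × ((k : ℕ) → makespan (take k σ) ≤ cost A (take k I))

IsOptA : {m : ℕ} → OnlineAlg m → List ℚ → ℚ → Set
IsOptA A I v =
  Σ (Schedule _) (λ σ → Feasible A I σ × (makespan σ ≡ v))
  × ((τ : Schedule _) → Feasible A I τ → v ≤ makespan τ)

BoundedRatioConst : {m : ℕ} → OnlineAlg m → ℚ → Set
BoundedRatioConst A c =
  (I : List ℚ) → All Positive I → (v : ℚ) → IsOptA A I v → cost A I ≤ c * v

module Submission where

-- The adversary releases jobs 1, 3, 1 and then looks at the machine the
-- algorithm chose for the second job of size 1.
--   * Same machine as the first 1: release m - 1 jobs of size 2.
--   * Different machine: release m - 2 jobs of size 3.
-- In both cases Opt_A = 3: every schedule has makespan ≥ 3 because of the job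
-- of size 3, an explicit schedule reaches 3, and that schedule respects the
-- prefix constraints (its first job costs what A's first job costs, and every
-- longer prefix already contains the job 3).  The online schedule, on the
-- other hand, has makespan ≥ 4: after merging the two 1's in the first case,
-- it consists of m + 1 jobs any two of which sum to ≥ 4 when they share a
-- machine, so by pigeonhole some machine gets two of them.  Hence
-- 4 ≤ A(I) ≤ c · 3.

open import Defs
open import Data.Nat using (ℕ)
open import Data.Integer using (+_)
open import Data.Rational using (ℚ; _≤_; _/_)

open import Data.Nat as ℕ using (zero; suc; s≤s; z≤n)
open import Data.Nat.Properties using (<⇒≱; n<1+n)
open import Data.Fin using (Fin; zero; suc; _≟_)
open import Data.Fin.Properties using (suc-injective; injective⇒≤)
open import Data.List using (List; []; _∷_; map; take; replicate; length; tabulate; allFin; lookup)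
open import Data.List.Properties using (length-map; length-replicate; ∷-injectiveˡ; ∷-injectiveʳ)
open import Data.List.Relation.Unary.All using (All; []; _∷_)
import Data.List.Relation.Unary.All as All
import Data.List.Relation.Unary.All.Properties as All
open import Data.List.Relation.Unary.AllPairs using (AllPairs; []; _∷_)
open import Data.List.Relation.Unary.Unique.Propositional using (Unique)
open import Data.List.Relation.Unary.Any using (here; there; any?)
open import Data.List.Membership.Propositional using (_∈_)
open import Data.List.Membership.Propositional.Properties using (∈-map⁻; ∈-lookup; ∈-allFin)
open import Data.Product using (∃; _×_; _,_; proj₁; proj₂)
open import Data.Rational using (0ℚ; _+_; _*_; _⊔_; _≤?_)
open import Data.Rational.Properties
  using (≤-trans; ≤-refl; ≤-reflexive; ≤-antisym; +-mono-≤; +-monoʳ-≤; +-assoc; +-comm;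
         +-identityˡ; +-identityʳ; p≤p⊔q; p≤q⇒p≤r⊔q; ⊔-lub; ⊔-mono-≤; *-cancelʳ-≤-pos)
open import Data.Empty using (⊥-elim)
open import Data.Sum using (_⊎_; inj₁; inj₂)
open import Function.Definitions using (Injective)
open import Relation.Binary.PropositionalEquality
  using (_≡_; _≢_; refl; sym; trans; cong; subst; module ≡-Reasoning)
open import Relation.Nullary using (yes; no; Dec)
open import Relation.Nullary.Decidable using (True; toWitness)

by-computation : (p q : ℚ) → {True (p ≤? q)} → p ≤ q
by-computation p q {t} = toWitness t

one two three four : ℚ
one   = + 1 / 1
two   = + 2 / 1
three = + 3 / 1
four  = + 4 / 1

NonNeg : {m : ℕ} → Schedule m → Set
NonNeg = All (λ job → 0ℚ ≤ proj₁ job)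

nonneg-of-input : {m : ℕ} {xs : List ℚ} (s : Schedule m) →
  map proj₁ s ≡ xs → All (0ℚ ≤_) xs → NonNeg s
nonneg-of-input s refl xs≥0 = All.map⁻ xs≥0

x≤y+x : {x y : ℚ} → 0ℚ ≤ y → x ≤ y + x
x≤y+x {x} {y} y≥0 = subst (_≤ y + x) (+-identityˡ x) (+-mono-≤ y≥0 (≤-refl {x}))

x≤x+y : {x y : ℚ} → 0ℚ ≤ y → x ≤ x + y
x≤x+y {x} {y} y≥0 = subst (_≤ x + y) (+-identityʳ x) (+-mono-≤ (≤-refl {x}) y≥0)

load-on : {m : ℕ} (x : ℚ) {j i : Fin m} (s : Schedule m) →
  j ≡ i → load ((x , j) ∷ s) i ≡ x + load s i
load-on x {j} {i} s j≡i with j ≟ i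
... | yes _   = refl
... | no j≢i  = ⊥-elim (j≢i j≡i)

load-off : {m : ℕ} (x : ℚ) {j i : Fin m} (s : Schedule m) →
  j ≢ i → load ((x , j) ∷ s) i ≡ load s i
load-off x {j} {i} s j≢i with j ≟ i
... | yes j≡i = ⊥-elim (j≢i j≡i)
... | no _    = refl

load-nonneg : {m : ℕ} (s : Schedule m) (i : Fin m) → NonNeg s → 0ℚ ≤ load s i
load-nonneg []            i _           = ≤-refl
load-nonneg ((x , j) ∷ s) i (x≥0 ∷ s≥0) with j ≟ i
... | yes _ = ≤-trans (load-nonneg s i s≥0) (x≤y+x x≥0)
... | no _  = load-nonneg s i s≥0

load-cons : {m : ℕ} (job : ℚ × Fin m) (s : Schedule m) (i : Fin m) →
  0ℚ ≤ proj₁ job → load s i ≤ load (job ∷ s) i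
load-cons (x , j) s i x≥0 with j ≟ i
... | yes _ = x≤y+x x≥0
... | no _  = ≤-refl

job≤load : {m : ℕ} {job : ℚ × Fin m} (s : Schedule m) → NonNeg s →
  job ∈ s → proj₁ job ≤ load s (proj₂ job)
job≤load ((x , j) ∷ s) (_ ∷ s≥0) (here refl) =
  subst (x ≤_) (sym (load-on x s refl)) (x≤x+y (load-nonneg s j s≥0))
job≤load (job′ ∷ s) (x≥0 ∷ s≥0) (there job∈s) =
  ≤-trans (job≤load s s≥0 job∈s) (load-cons job′ s _ x≥0)

pair≤load : {m : ℕ} (x : ℚ) (j : Fin m) {job : ℚ × Fin m} (s : Schedule m) →
  NonNeg s → job ∈ s → proj₂ job ≡ j → x + proj₁ job ≤ load ((x , j) ∷ s) j
pair≤load x j s s≥0 job∈s refl =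
  subst (x + _ ≤_) (sym (load-on x s refl)) (+-monoʳ-≤ x (job≤load s s≥0 job∈s))

load-take : {m : ℕ} (k : ℕ) (s : Schedule m) (i : Fin m) →
  NonNeg s → load (take k s) i ≤ load s i
load-take zero    s             i s≥0           = load-nonneg s i s≥0
load-take (suc k) []            i _             = ≤-refl
load-take (suc k) ((x , j) ∷ s) i (_ ∷ s≥0) with j ≟ i
... | yes _ = +-monoʳ-≤ x (load-take k s i s≥0)
... | no _  = load-take k s i s≥0

load-merge : {m : ℕ} (x z : ℚ) (j : Fin m) (job : ℚ × Fin m) (s : Schedule m) (i : Fin m) →
  load ((x , j) ∷ job ∷ (z , j) ∷ s) i ≡ load ((x + z , j) ∷ job ∷ s) i
load-merge x z j (y , l) s i = by-cases (j ≟ i) (l ≟ i)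
  where
  open ≡-Reasoning
  L = load s i
  by-cases : Dec (j ≡ i) → Dec (l ≡ i) →
    load ((x , j) ∷ (y , l) ∷ (z , j) ∷ s) i ≡ load ((x + z , j) ∷ (y , l) ∷ s) i
  by-cases (yes j≡i) (yes l≡i) = begin
    load ((x , j) ∷ (y , l) ∷ (z , j) ∷ s) i
      ≡⟨ load-on x _ j≡i ⟩
    x + load ((y , l) ∷ (z , j) ∷ s) i
      ≡⟨ cong (_+_ x) (trans (load-on y _ l≡i) (cong (_+_ y) (load-on z s j≡i))) ⟩
    x + (y + (z + L))   ≡⟨ cong (_+_ x) (sym (+-assoc y z L)) ⟩
    x + ((y + z) + L)   ≡⟨ cong (λ w → x + (w + L)) (+-comm y z) ⟩
    x + ((z + y) + L)   ≡⟨ cong (_+_ x) (+-assoc z y L) ⟩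
    x + (z + (y + L))   ≡⟨ sym (+-assoc x z (y + L)) ⟩
    (x + z) + (y + L)   ≡⟨ sym (trans (load-on (x + z) _ j≡i) (cong (_+_ (x + z)) (load-on y s l≡i))) ⟩
    load ((x + z , j) ∷ (y , l) ∷ s) i ∎
  by-cases (yes j≡i) (no l≢i) = begin
    load ((x , j) ∷ (y , l) ∷ (z , j) ∷ s) i
      ≡⟨ load-on x _ j≡i ⟩
    x + load ((y , l) ∷ (z , j) ∷ s) i
      ≡⟨ cong (_+_ x) (trans (load-off y _ l≢i) (load-on z s j≡i)) ⟩
    x + (z + L)         ≡⟨ sym (+-assoc x z L) ⟩
    (x + z) + L         ≡⟨ sym (trans (load-on (x + z) _ j≡i) (cong (_+_ (x + z)) (load-off y s l≢i))) ⟩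
    load ((x + z , j) ∷ (y , l) ∷ s) i ∎
  by-cases (no j≢i) (yes l≡i) = begin
    load ((x , j) ∷ (y , l) ∷ (z , j) ∷ s) i
      ≡⟨ trans (load-off x _ j≢i) (load-on y _ l≡i) ⟩
    y + load ((z , j) ∷ s) i ≡⟨ cong (_+_ y) (load-off z s j≢i) ⟩
    y + L               ≡⟨ sym (trans (load-off (x + z) _ j≢i) (load-on y s l≡i)) ⟩
    load ((x + z , j) ∷ (y , l) ∷ s) i ∎
  by-cases (no j≢i) (no l≢i) = begin
    load ((x , j) ∷ (y , l) ∷ (z , j) ∷ s) i
      ≡⟨ trans (load-off x _ j≢i) (trans (load-off y _ l≢i) (load-off z s j≢i)) ⟩
    L                   ≡⟨ sym (trans (load-off (x + z) _ j≢i) (load-off y s l≢i)) ⟩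
    load ((x + z , j) ∷ (y , l) ∷ s) i ∎

makespan-step : {m : ℕ} → Schedule m → Fin m → ℚ → ℚ
makespan-step s i r = load s i ⊔ r

load≤makespan : {m : ℕ} (s : Schedule m) (i : Fin m) → load s i ≤ makespan s
load≤makespan {m} s i = go (allFin m) (∈-allFin i)
  where
  go : (is : List (Fin m)) → i ∈ is → load s i ≤ Data.List.foldr (makespan-step s) 0ℚ is
  go (_ ∷ is) (here refl) = p≤p⊔q _ _
  go (j ∷ is) (there i∈is) = p≤q⇒p≤r⊔q (load s j) (go is i∈is)

makespan≤ : {m : ℕ} (s : Schedule m) (q : ℚ) → 0ℚ ≤ q → (∀ i → load s i ≤ q) →
  makespan s ≤ q
makespan≤ {m} s q q≥0 loads≤q = go (allFin m)
  where
  go : (is : List (Fin m)) → Data.List.foldr (makespan-step s) 0ℚ is ≤ q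
  go []       = q≥0
  go (i ∷ is) = ⊔-lub (loads≤q i) (go is)

makespan-mono : {m : ℕ} (s t : Schedule m) → (∀ i → load s i ≤ load t i) →
  makespan s ≤ makespan t
makespan-mono {m} s t s≤t = go (allFin m)
  where
  go : (is : List (Fin m)) →
    Data.List.foldr (makespan-step s) 0ℚ is ≤ Data.List.foldr (makespan-step t) 0ℚ is
  go []       = ≤-refl
  go (i ∷ is) = ⊔-mono-≤ (s≤t i) (go is)

job≤makespan : {m : ℕ} {job : ℚ × Fin m} (s : Schedule m) → NonNeg s →
  job ∈ s → proj₁ job ≤ makespan s
job≤makespan s s≥0 job∈s = ≤-trans (job≤load s s≥0 job∈s) (load≤makespan s _)

makespan-single : {m : ℕ} (x : ℚ) (j : Fin m) → 0ℚ ≤ x → makespan ((x , j) ∷ []) ≤ x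
makespan-single x j x≥0 = makespan≤ ((x , j) ∷ []) x x≥0 single≤x
  where
  single≤x : ∀ i → load ((x , j) ∷ []) i ≤ x
  single≤x i with j ≟ i
  ... | yes _ = ≤-reflexive (+-identityʳ x)
  ... | no _  = x≥0

distinct⇒length≤ : {m : ℕ} (is : List (Fin m)) → Unique is → length is ℕ.≤ m
distinct⇒length≤ is distinct = injective⇒≤ (lookup-injective is distinct)
  where
  lookup-injective : {m : ℕ} (is : List (Fin m)) → Unique is →
    Injective _≡_ _≡_ (lookup is)
  lookup-injective (_ ∷ _)  (_ ∷ _)  {zero}  {zero}  _  = refl
  lookup-injective (_ ∷ is) (i∉is ∷ _) {zero} {suc b} eq =
    ⊥-elim (All.lookup i∉is (∈-lookup b) eq)
  lookup-injective (_ ∷ is) (i∉is ∷ _) {suc a} {zero} eq =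
    ⊥-elim (All.lookup i∉is (∈-lookup a) (sym eq))
  lookup-injective (_ ∷ is) (_ ∷ distinct) {suc a} {suc b} eq =
    cong suc (lookup-injective is distinct eq)

Clash : {m : ℕ} → ℚ → ℚ × Fin m → ℚ × Fin m → Set
Clash h (x , j) (y , l) = j ≡ l → h ≤ x + y

heavy-or-distinct : {m : ℕ} {h : ℚ} (s : Schedule m) → NonNeg s →
  AllPairs (Clash h) s → (∃ λ i → h ≤ load s i) ⊎ Unique (map proj₂ s)
heavy-or-distinct []            _           _                = inj₂ []
heavy-or-distinct ((x , j) ∷ s) (x≥0 ∷ s≥0) (clashes ∷ pairs) with any? (j ≟_) (map proj₂ s)
... | yes j∈s = let (job , job∈s , j≡l) = ∈-map⁻ proj₂ j∈s in
  inj₁ (j , ≤-trans (All.lookup clashes job∈s j≡l) (pair≤load x j s s≥0 job∈s (sym j≡l)))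
... | no j∉s with heavy-or-distinct s s≥0 pairs
...   | inj₁ (i , heavy) = inj₁ (i , ≤-trans heavy (load-cons (x , j) s i x≥0))
...   | inj₂ distinct    = inj₂ (All.¬Any⇒All¬ _ j∉s ∷ distinct)

overfull⇒makespan≥ : {m : ℕ} {h : ℚ} (s : Schedule m) → m ℕ.< length s →
  NonNeg s → AllPairs (Clash h) s → h ≤ makespan s
overfull⇒makespan≥ {m} s overfull s≥0 pairs with heavy-or-distinct s s≥0 pairs
... | inj₁ (i , heavy) = ≤-trans heavy (load≤makespan s i)
... | inj₂ distinct    = ⊥-elim (<⇒≱ overfull
  (subst (ℕ._≤ m) (length-map proj₂ s) (distinct⇒length≤ (map proj₂ s) distinct)))

clashes-with-large : {m : ℕ} {h p q : ℚ} (job : ℚ × Fin m) (s : Schedule m) →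
  h ≤ p + q → p ≤ proj₁ job → All (λ job′ → q ≤ proj₁ job′) s → All (Clash h job) s
clashes-with-large job s h≤p+q p≤x large =
  All.map (λ q≤y _ → ≤-trans h≤p+q (+-mono-≤ p≤x q≤y)) large

large-pairs-clash : {m : ℕ} {h q : ℚ} (s : Schedule m) → h ≤ q + q →
  All (λ job → q ≤ proj₁ job) s → AllPairs (Clash h) s
large-pairs-clash []        h≤2q []            = []
large-pairs-clash (job ∷ s) h≤2q (q≤x ∷ large) =
  clashes-with-large job s h≤2q q≤x large ∷ large-pairs-clash s h≤2q large

run-jobs : {m : ℕ} (A : OnlineAlg m) (seen xs : List ℚ) → map proj₁ (runFrom A seen xs) ≡ xs
run-jobs A seen []       = refl
run-jobs A seen (x ∷ xs) = cong (x ∷_) (run-jobs A _ xs)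

run-length : {m : ℕ} (A : OnlineAlg m) (seen xs : List ℚ) → length (runFrom A seen xs) ≡ length xs
run-length A seen xs = trans (sym (length-map proj₁ (runFrom A seen xs))) (cong length (run-jobs A seen xs))

run-all : {m : ℕ} {P : ℚ → Set} (A : OnlineAlg m) (seen xs : List ℚ) →
  All P xs → All (λ job → P (proj₁ job)) (runFrom A seen xs)
run-all A seen xs Pxs = All.map⁻ (subst (All _) (sym (run-jobs A seen xs)) Pxs)

-- If I = x ∷ y ∷ rest with 0 ≤ x ≤ y and some schedule of I has all loads ≤ y,
-- then Opt_A(I) = y: y lower-bounds every schedule, and the schedule is
-- prefix-feasible since A pays x on the first prefix and ≥ y on longer ones.
optA-second-job : {m : ℕ} (A : OnlineAlg m) (x y : ℚ) (rest : List ℚ) →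
  0ℚ ≤ x → x ≤ y → All (0ℚ ≤_) rest →
  (σ : Schedule m) → map proj₁ σ ≡ x ∷ y ∷ rest → (∀ i → load σ i ≤ y) →
  IsOptA A (x ∷ y ∷ rest) y
optA-second-job {m} A x y rest x≥0 x≤y rest≥0 σ σ-jobs σ≤y =
  (σ , (σ-jobs , prefixes) , ≤-antisym (makespan≤ σ y y≥0 σ≤y) (y≤makespan σ σ-jobs))
  , λ τ (τ-jobs , _) → y≤makespan τ τ-jobs
  where
  y≥0 = ≤-trans x≥0 x≤y
  I≥0 : All (0ℚ ≤_) (x ∷ y ∷ rest)
  I≥0 = x≥0 ∷ y≥0 ∷ rest≥0
  y≤makespan : (τ : Schedule m) → map proj₁ τ ≡ x ∷ y ∷ rest → y ≤ makespan τ
  y≤makespan τ@(_ ∷ _ ∷ _) τ-jobs =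
    subst (_≤ makespan τ) (∷-injectiveˡ (∷-injectiveʳ τ-jobs))
      (job≤makespan τ (nonneg-of-input τ τ-jobs I≥0) (there (here refl)))
  prefixes : (k : ℕ) → makespan (take k σ) ≤ cost A (take k (x ∷ y ∷ rest))
  prefixes zero = ≤-refl
  prefixes (suc zero) = first-prefix σ σ-jobs
    where
    first-prefix : (τ : Schedule m) → map proj₁ τ ≡ x ∷ y ∷ rest →
      makespan (take 1 τ) ≤ cost A (x ∷ [])
    first-prefix ((x′ , j) ∷ _) τ-jobs rewrite ∷-injectiveˡ τ-jobs =
      ≤-trans (makespan-single x j x≥0) (job≤makespan (run A (x ∷ [])) (x≥0 ∷ []) (here refl))
  prefixes (suc (suc k)) =
    ≤-trans (makespan-mono (take (suc (suc k)) σ) σ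
               (λ i → load-take (suc (suc k)) σ i (nonneg-of-input σ σ-jobs I≥0)))
    (≤-trans (makespan≤ σ y y≥0 σ≤y)
             (job≤makespan run-prefix
               (run-all A [] _ (x≥0 ∷ y≥0 ∷ All.take⁺ k rest≥0)) (there (here refl))))
    where run-prefix = run A (x ∷ y ∷ take k rest)

spread : {n m : ℕ} → ℚ → (Fin n → Fin m) → Schedule m
spread x g = tabulate (λ j → (x , g j))

spread-jobs : {n m : ℕ} (x : ℚ) (g : Fin n → Fin m) → map proj₁ (spread x g) ≡ replicate n x
spread-jobs {zero}  x g = refl
spread-jobs {suc n} x g = cong (x ∷_) (spread-jobs x (λ j → g (suc j)))

load-spread-miss : {n m : ℕ} (x : ℚ) (g : Fin n → Fin m) (i : Fin m) →
  (∀ j → g j ≢ i) → load (spread x g) i ≡ 0ℚ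
load-spread-miss {zero}  x g i missed = refl
load-spread-miss {suc n} x g i missed =
  trans (load-off x _ (missed zero)) (load-spread-miss x (λ j → g (suc j)) i (λ j → missed (suc j)))

load-spread-≤ : {n m : ℕ} (x : ℚ) (g : Fin n → Fin m) (i : Fin m) →
  0ℚ ≤ x → Injective _≡_ _≡_ g → load (spread x g) i ≤ x
load-spread-≤ {zero}  x g i x≥0 g-inj = x≥0
load-spread-≤ {suc n} x g i x≥0 g-inj with g zero ≟ i
... | yes g0≡i = ≤-reflexive (trans (cong (_+_ x) (load-spread-miss x _ i missed)) (+-identityʳ x))
  where
  missed : ∀ j → g (suc j) ≢ i
  missed j gsj≡i with g-inj (trans gsj≡i (sym g0≡i))
  ... | ()
... | no _ = load-spread-≤ x (λ j → g (suc j)) i x≥0 (λ eq → suc-injective (g-inj eq))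

inputSame : ℕ → List ℚ
inputSame k = one ∷ three ∷ one ∷ replicate (suc (suc k)) two

inputDifferent : ℕ → List ℚ
inputDifferent k = one ∷ three ∷ one ∷ replicate (suc k) three

module Adversary (k : ℕ) (A : OnlineAlg (suc (suc (suc k)))) where

  M : ℕ
  M = suc (suc (suc k))

  a b u : Fin M
  a = A [] one
  b = A (one ∷ []) three
  u = A (one ∷ three ∷ []) one

  tail : List ℚ → Schedule M
  tail = runFrom A (one ∷ three ∷ one ∷ [])

  tail-length : (n : ℕ) (x : ℚ) → length (tail (replicate n x)) ≡ n
  tail-length n x = trans (run-length A _ (replicate n x)) (length-replicate n)

  tail-at-least : (n : ℕ) (x : ℚ) → All (λ job → x ≤ proj₁ job) (tail (replicate n x))
  tail-at-least n x = run-all A _ (replicate n x) (All.replicate⁺ n (≤-refl {x}))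

  -- Both 1's on machine a: merged they form m + 1 jobs of size ≥ 2.
  online-same : u ≡ a → four ≤ cost A (inputSame k)
  online-same u≡a =
    ≤-trans merged≥4 (makespan-mono merged (run A (inputSame k)) (λ i → ≤-reflexive (same-loads i)))
    where
    T = tail (replicate (suc (suc k)) two)
    merged = (one + one , a) ∷ (three , b) ∷ T
    same-loads : ∀ i → load merged i ≡ load (run A (inputSame k)) i
    same-loads i = sym (trans (cong (λ v → load ((one , a) ∷ (three , b) ∷ (one , v) ∷ T) i) u≡a)
                              (load-merge one one a (three , b) T i))
    merged≥2 : All (λ job → two ≤ proj₁ job) merged
    merged≥2 = by-computation two (one + one) ∷ by-computation two three
             ∷ tail-at-least (suc (suc k)) two
    merged≥4 : four ≤ makespan merged
    merged≥4 = overfull⇒makespan≥ merged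
      (subst (λ n → M ℕ.< suc (suc n)) (sym (tail-length (suc (suc k)) two)) (n<1+n M))
      (All.map (≤-trans (by-computation 0ℚ two)) merged≥2)
      (large-pairs-clash merged (by-computation four (two + two)) merged≥2)

  -- The 1's on different machines: m - 1 jobs of size 3 and two 1's apart.
  online-different : u ≢ a → four ≤ cost A (inputDifferent k)
  online-different u≢a = overfull⇒makespan≥ s
    (subst (λ n → M ℕ.< suc (suc (suc n))) (sym (tail-length (suc k) three)) (n<1+n M))
    (0≤1 ∷ by-computation 0ℚ three ∷ 0≤1 ∷ All.map (≤-trans (by-computation 0ℚ three)) T≥3)
    (first-one ∷ the-three ∷ second-one ∷ large-pairs-clash T (by-computation four (three + three)) T≥3)
    where
    0≤1 = by-computation 0ℚ one
    T = tail (replicate (suc k) three)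
    s = (one , a) ∷ (three , b) ∷ (one , u) ∷ T
    T≥3 : All (λ job → three ≤ proj₁ job) T
    T≥3 = tail-at-least (suc k) three
    -- A 1 clashes with every 3, and the two 1's never share a machine.
    first-one : All (Clash four (one , a)) ((three , b) ∷ (one , u) ∷ T)
    first-one = (λ _ → by-computation four (one + three))
              ∷ (λ a≡u → ⊥-elim (u≢a (sym a≡u)))
              ∷ clashes-with-large _ T (by-computation four (one + three)) ≤-refl T≥3
    the-three : All (Clash four (three , b)) ((one , u) ∷ T)
    the-three = (λ _ → by-computation four (three + one))
              ∷ clashes-with-large _ T (by-computation four (three + three)) ≤-refl T≥3
    second-one : All (Clash four (one , u)) T
    second-one = clashes-with-large _ T (by-computation four (one + three)) ≤-refl T≥3

  -- Opt_A = 3 via 3 | 1,2 | 1,2 | 2 | ... | 2.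
  opt-same : IsOptA A (inputSame k) three
  opt-same = optA-second-job A one three _ (by-computation 0ℚ one) (by-computation one three)
    (by-computation 0ℚ one ∷ All.replicate⁺ (suc (suc k)) (by-computation 0ℚ two))
    σ (cong (λ r → one ∷ three ∷ one ∷ r) (spread-jobs two suc)) σ≤3
    where
    twos : Schedule M
    twos = spread {suc (suc k)} two suc
    σ : Schedule M
    σ = (one , suc zero) ∷ (three , zero) ∷ (one , suc (suc zero)) ∷ twos
    twos≤2 : ∀ i → load twos i ≤ two
    twos≤2 i = load-spread-≤ two suc i (by-computation 0ℚ two) suc-injective
    σ≤3 : ∀ i → load σ i ≤ three
    σ≤3 zero = ≤-trans (+-monoʳ-≤ three (≤-reflexive (load-spread-miss {suc (suc k)} two suc zero (λ _ ()))))
                       (by-computation (three + 0ℚ) three)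
    σ≤3 i@(suc zero) = ≤-trans (+-monoʳ-≤ one (twos≤2 i)) (by-computation (one + two) three)
    σ≤3 i@(suc (suc zero)) = ≤-trans (+-monoʳ-≤ one (twos≤2 i)) (by-computation (one + two) three)
    σ≤3 i@(suc (suc (suc _))) = ≤-trans (twos≤2 i) (by-computation two three)

  -- Opt_A = 3 via 1,1 | 3 | 3 | ... | 3.
  opt-different : IsOptA A (inputDifferent k) three
  opt-different = optA-second-job A one three _ (by-computation 0ℚ one) (by-computation one three)
    (by-computation 0ℚ one ∷ All.replicate⁺ (suc k) (by-computation 0ℚ three))
    σ (cong (λ r → one ∷ three ∷ one ∷ r) (spread-jobs three g)) σ≤3
    where
    g : Fin (suc k) → Fin M
    g j = suc (suc j)
    σ : Schedule M
    σ = (one , zero) ∷ (three , suc zero) ∷ (one , zero) ∷ spread three g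
    σ≤3 : ∀ i → load σ i ≤ three
    σ≤3 zero = ≤-trans (+-monoʳ-≤ one (+-monoʳ-≤ one (≤-reflexive (load-spread-miss three g zero (λ _ ())))))
                       (by-computation (one + (one + 0ℚ)) three)
    σ≤3 (suc zero) = ≤-trans (+-monoʳ-≤ three (≤-reflexive (load-spread-miss three g (suc zero) (λ _ ()))))
                             (by-computation (three + 0ℚ) three)
    σ≤3 i@(suc (suc _)) = load-spread-≤ three g i (by-computation 0ℚ three)
                          (λ eq → suc-injective (suc-injective eq))

ratio≥4/3 : {p c : ℚ} → four ≤ p → p ≤ c * three → (+ 4) / 3 ≤ c
ratio≥4/3 4≤p p≤3c = *-cancelʳ-≤-pos three
  (≤-trans (by-computation ((+ 4 / 3) * three) four) (≤-trans 4≤p p≤3c))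

theorem5 : (m : ℕ) → 3 Data.Nat.≤ m → (A : OnlineAlg m) → (c : ℚ) →
    BoundedRatioConst A c → (+ 4) / 3 ≤ c
theorem5 (suc (suc (suc k))) (s≤s (s≤s (s≤s z≤n))) A c bounded =
  case-on-third-job (u ≟ a)
  where
  open Adversary k A
  case-on-third-job : Dec (u ≡ a) → (+ 4) / 3 ≤ c
  case-on-third-job (yes u≡a) = ratio≥4/3 (online-same u≡a)
    (bounded (inputSame k) (_ ∷ _ ∷ _ ∷ All.replicate⁺ _ _) three opt-same)
  case-on-third-job (no u≢a) = ratio≥4/3 (online-different u≢a)
    (bounded (inputDifferent k) (_ ∷ _ ∷ _ ∷ All.replicate⁺ _ _) three opt-different)
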